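{- Let $1\le a\le k$ and $1\le i\le n$, and assume $O^{(a)}_i\neq\emptyset$. Then the set $\mathbb{O}^{(a)}_i\cup\{o^{(a)}_i\}$ contains an optimal option for $F_a[i]$. Consequently, $$F_a[i]=\min\{F[j]+c_a\cdot S_{j+1,i} : j\in\mathbb{O}^{(a)}_i\cup\{o^{(a)}_i\}\}.$$
   Context: Partition and assign problem: given thresholds $w_0^{(1)},\ldots,w_0^{(k)}$, coefficients $c_1,\ldots,c_k$, and $n$ jobs $1,\ldots,n$, job $i$ having $(w_i,s_i)$, all parameters nonnegative. A group of consecutive jobs $i,\ldots,j$ can be processed in a batch by an agent of type $a$ if $w_i+\cdots+w_j\le w_0^{(a)}$, at cost $c_a\max\{s_i,\ldots,s_j\}$; one seeks a partition into consecutive groups and an agent type for each minimizing the total cost. Write $W_{x,y}=\sum_{x\le v\le y}w_v$, $S_{x,y}=\max\{s_v:x\le v\le y\}$. Let $F[0]=0$ and for $1\le i\le n$, $F[i]=\min_{1\le a\le k}F_a[i]$, where $F_a[i]=\min\{F[j]+c_a S_{j+1,i}: 0\le j<i,\ W_{j+1,i}\le w_0^{(a)}\}$ (minimum over the empty set is $+\infty$). Let $O^{(a)}_i=\{j:0\le j<i,\ W_{j+1,i}\le w_0^{(a)}\}$ (the $a$-options of $i$), $o^{(a)}_i=\min O^{(a)}_i$, and $\mathbb{O}^{(a)}_i=\{j\in O^{(a)}_i: j>0,\ s_j>S_{j+1,i}\}$. An option $j\in O^{(a)}_i$ is optimal for $F_a[i]$ if $F[j]+c_aS_{j+1,i}=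F_a[i]$.
   Formalization: The thresholds $w_0^{(1)},\ldots,w_0^{(k)}$, coefficients $c_1,\ldots,c_k$ and job parameters $(w_i,s_i)$ are nonnegative rationals. -}

module Defs where

open import Data.Nat using (ℕ; zero; suc; _∸_) renaming (_+_ to _+ℕ_; _≤_ to _≤ℕ_; _≤ᵇ_ to _≤ᵇℕ_)
import Data.Nat
open import Data.Rational using (ℚ; 0ℚ; _+_; _*_; _≤_; _⊔_; _⊓_; _≤ᵇ_; _<_)
open import Data.List using (List; []; _∷_; map; foldr; upTo)
open import Data.Bool using (if_then_else_)
open import Data.Product using (_×_)

-- Extended nonnegative costs: rationals with +∞ (min over the empty set).
data ℚ∞ : Set where
  fin : ℚ → ℚ∞
  ∞   : ℚ∞

_+∞_ : ℚ∞ → ℚ∞ → ℚ∞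
fin x +∞ fin y = fin (x + y)
_     +∞ _     = ∞

min∞ : ℚ∞ → ℚ∞ → ℚ∞
min∞ (fin x) (fin y) = fin (x ⊓ y)
min∞ (fin x) ∞       = fin x
min∞ ∞       y       = y

data _≤∞_ : ℚ∞ → ℚ∞ → Set where
  fin≤fin : ∀ {x y} → x ≤ y → fin x ≤∞ fin y
  _≤∞∞    : ∀ x → x ≤∞ ∞

minList : List ℚ∞ → ℚ∞
minList = foldr min∞ ∞

-- the indices x, x+1, ..., y  (empty if y < x)
range : ℕ → ℕ → List ℕ
range x y = map (x +ℕ_) (upTo (suc y ∸ x))

W : (ℕ → ℚ) → ℕ → ℕ → ℚ
W w x y = foldr _+_ 0ℚ (map w (range x y))

-- S_{x,y} = max { s_v : x ≤ v ≤ y }  (only used for nonempty ranges with s ≥ 0,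
-- so the base value 0 does not affect the maximum)
S : (ℕ → ℚ) → ℕ → ℕ → ℚ
S s x y = foldr _⊔_ 0ℚ (map s (range x y))

-- An instance: thresholds w0, coefficients c (agent types indexed 1..k),
-- job weights w and sizes s (jobs indexed 1..n).
-- F_a[i] computed from a table G of already known values F[j], j < i:
--   min { G j + c_a S_{j+1,i} : 0 ≤ j < i, W_{j+1,i} ≤ w0_a }
FaWith : (w0 c w s : ℕ → ℚ) → (ℕ → ℚ∞) → ℕ → ℕ → ℚ∞
FaWith w0 c w s G a i =
  minList (map (λ j → if W w (suc j) i ≤ᵇ w0 a
                        then G j +∞ fin (c a * S s (suc j) i)
                        else ∞)
               (upTo i))

FWith : (k : ℕ) → (w0 c w s : ℕ → ℚ) → (ℕ → ℚ∞) → ℕ → ℚ∞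
FWith k w0 c w s G i = minList (map (λ a → FaWith w0 c w s G a i) (range 1 k))

-- table of F[0..i]: Ftab i j = F[j] for j ≤ i
Ftab : (k : ℕ) → (w0 c w s : ℕ → ℚ) → ℕ → ℕ → ℚ∞
Ftab k w0 c w s zero    j = fin 0ℚ
Ftab k w0 c w s (suc i) j =
  if j ≤ᵇℕ i then Ftab k w0 c w s i j
  else FWith k w0 c w s (Ftab k w0 c w s i) (suc i)

F : (k : ℕ) → (w0 c w s : ℕ → ℚ) → ℕ → ℚ∞
F k w0 c w s i = Ftab k w0 c w s i i

Fa : (k : ℕ) → (w0 c w s : ℕ → ℚ) → ℕ → ℕ → ℚ∞
Fa k w0 c w s a i = FaWith w0 c w s (F k w0 c w s) a i

-- j ∈ O^{(a)}_i
IsOption : (w0 w : ℕ → ℚ) → ℕ → ℕ → ℕ → Set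
IsOption w0 w a i j = (j Data.Nat.< i) × (W w (suc j) i ≤ w0 a)

-- j ∈ 𝕆^{(a)}_i
IsBreakOption : (w0 w s : ℕ → ℚ) → ℕ → ℕ → ℕ → Set
IsBreakOption w0 w s a i j =
  IsOption w0 w a i j × (0 Data.Nat.< j) × (S s (suc j) i < s j)

-- j = o^{(a)}_i = min O^{(a)}_i
IsMinOption : (w0 w : ℕ → ℚ) → ℕ → ℕ → ℕ → Set
IsMinOption w0 w a i j =
  IsOption w0 w a i j × (∀ j′ → IsOption w0 w a i j′ → j ≤ℕ j′)

optCost : (k : ℕ) → (w0 c w s : ℕ → ℚ) → ℕ → ℕ → ℕ → ℚ∞
optCost k w0 c w s a i j = F k w0 c w s j +∞ fin (c a * S s (suc j) i)

{-# OPTIONS --safe #-}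
-- F is nondecreasing: the last batch j+1..m+1 of an optimal solution for F[m+1] is either the single job
-- m+1, or, cut at m, a batch for F[m] that is no heavier and no more expensive (w, c ≥ 0).
-- Now walk left from an option j attaining F_a[i]. If j > 0 is not in 𝕆, then s_j ≤ S_{j+1,i}, so
-- S_{j,i} = S_{j+1,i}; if j-1 is still an option, its cost F[j-1] + c_a S_{j,i} is at most F[j] + c_a S_{j+1,i}
-- by monotonicity, and otherwise j = o_i, since the options form an upward-closed set.
module Submission where

open import Defs
open import Data.Nat using (ℕ; _≤_)
open import Data.Rational using (ℚ; 0ℚ) renaming (_≤_ to _≤ℚ_)
open import Data.Product using (Σ; ∃; _×_)
open import Data.Sum using (_⊎_)
open import Relation.Binary.PropositionalEquality using (_≡_)

open import Data.Nat using (zero; suc; _∸_; _<_; _≤′_; ≤′-refl; ≤′-step; z≤n; s≤s) renaming (_+_ to _+ℕ_; _≤ᵇ_ to _≤ᵇℕ_)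
import Data.Nat.Properties as ℕ
open import Data.Rational using (_+_; _*_; _⊔_; _≤ᵇ_; nonNegative) renaming (_<_ to _<ℚ_)
import Data.Rational.Properties as ℚ
open import Data.List using ([]; _∷_; _++_; _∷ʳ_; [_]; map; foldr; upTo)
open import Data.List.Properties using (map-++; foldr-++; upTo-∷ʳ; ++-assoc; ++-identityʳ; map-cong; map-cong-local)
open import Data.List.Membership.Propositional using (_∈_)
open import Data.List.Membership.Propositional.Properties using (∈-map⁺; ∈-map⁻; ∈-upTo⁺; ∈-upTo⁻)
open import Data.List.Relation.Unary.All as All using (All)
import Data.List.Relation.Unary.All.Properties as All
open import Data.List.Relation.Unary.Any using (here; there)
open import Data.Bool using (true; false; if_then_else_)
open import Data.Bool.Properties using (if-cong; T-≡)
open import Function.Bundles using (Equivalence)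
open import Relation.Binary.Bundles using (Preorder)
open import Relation.Binary.Structures using (IsPreorder)
import Relation.Binary.Reasoning.Preorder as PreorderReasoning
open import Data.Product using (_,_; proj₂)
open import Data.Sum using (inj₁; inj₂; [_,_]′)
open import Function using (_∘_; _∘′_)
open import Relation.Nullary using (¬_; yes; no)
open import Relation.Binary.PropositionalEquality using (isEquivalence; refl; sym; trans; cong; subst; module ≡-Reasoning)

≤∞-refl : ∀ {x} → x ≤∞ x
≤∞-refl {fin x} = fin≤fin ℚ.≤-refl
≤∞-refl {∞}     = ∞ ≤∞∞

≤∞-trans : ∀ {x y z} → x ≤∞ y → y ≤∞ z → x ≤∞ z
≤∞-trans (fin≤fin p) (fin≤fin q) = fin≤fin (ℚ.≤-trans p q)
≤∞-trans _           (_ ≤∞∞)     = _ ≤∞∞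

≤∞-antisym : ∀ {x y} → x ≤∞ y → y ≤∞ x → x ≡ y
≤∞-antisym (fin≤fin p) (fin≤fin q) = cong fin (ℚ.≤-antisym p q)
≤∞-antisym (_ ≤∞∞)     (_ ≤∞∞)     = refl

≤∞-isPreorder : IsPreorder _≡_ _≤∞_
≤∞-isPreorder = record
  { isEquivalence = isEquivalence
  ; reflexive     = λ { refl → ≤∞-refl }
  ; trans         = ≤∞-trans
  }

≤∞-preorder : Preorder _ _ _
≤∞-preorder = record { isPreorder = ≤∞-isPreorder }

module ≤∞-Reasoning = PreorderReasoning ≤∞-preorder

+∞-monoˡ-≤ : ∀ {x y} z → x ≤∞ y → (x +∞ z) ≤∞ (y +∞ z)
+∞-monoˡ-≤ (fin z) (fin≤fin p) = fin≤fin (ℚ.+-monoˡ-≤ z p)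
+∞-monoˡ-≤ ∞       (fin≤fin _) = _ ≤∞∞
+∞-monoˡ-≤ _       (_ ≤∞∞)     = _ ≤∞∞

+∞-monoʳ-≤ : ∀ x {p q} → p ≤ℚ q → (x +∞ fin p) ≤∞ (x +∞ fin q)
+∞-monoʳ-≤ (fin x) p≤q = fin≤fin (ℚ.+-monoʳ-≤ x p≤q)
+∞-monoʳ-≤ ∞       _   = ∞ ≤∞∞

x≤∞x+∞q : ∀ x {q} → 0ℚ ≤ℚ q → x ≤∞ (x +∞ fin q)
x≤∞x+∞q (fin x) {q} 0≤q = fin≤fin (subst (_≤ℚ x + q) (ℚ.+-identityʳ x) (ℚ.+-monoʳ-≤ x 0≤q))
x≤∞x+∞q ∞       _       = ∞ ≤∞∞

min∞-≤ˡ : ∀ x y → min∞ x y ≤∞ x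
min∞-≤ˡ (fin x) (fin y) = fin≤fin (ℚ.p⊓q≤p x y)
min∞-≤ˡ (fin x) ∞       = ≤∞-refl
min∞-≤ˡ ∞       y       = y ≤∞∞

min∞-≤ʳ : ∀ x y → min∞ x y ≤∞ y
min∞-≤ʳ (fin x) (fin y) = fin≤fin (ℚ.p⊓q≤q x y)
min∞-≤ʳ (fin x) ∞       = _ ≤∞∞
min∞-≤ʳ ∞       y       = ≤∞-refl

min∞-sel : ∀ x y → min∞ x y ≡ x ⊎ min∞ x y ≡ y
min∞-sel (fin x) (fin y) with ℚ.⊓-sel x y
... | inj₁ eq = inj₁ (cong fin eq)
... | inj₂ eq = inj₂ (cong fin eq)
min∞-sel (fin x) ∞       = inj₁ refl
min∞-sel ∞       y       = inj₂ refl

min∞-∞ʳ : ∀ x → min∞ x ∞ ≡ x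
min∞-∞ʳ (fin x) = refl
min∞-∞ʳ ∞       = refl

minList-≤ : ∀ {x xs} → x ∈ xs → minList xs ≤∞ x
minList-≤ (here refl)  = min∞-≤ˡ _ _
minList-≤ (there x∈xs) = ≤∞-trans (min∞-≤ʳ _ _) (minList-≤ x∈xs)

minList-∈ : ∀ {x xs} → x ∈ xs → minList xs ∈ xs
minList-∈ {xs = y ∷ []}     _ = here (min∞-∞ʳ y)
minList-∈ {xs = y ∷ z ∷ zs} _ =
  [ here , (λ eq → there (subst (_∈ z ∷ zs) (sym eq) (minList-∈ {xs = z ∷ zs} (here refl)))) ]′
  (min∞-sel y (minList (z ∷ zs)))

foldr-monoʳ-≤ : ∀ (_∙_ : ℚ → ℚ → ℚ) → (∀ a {b c} → b ≤ℚ c → a ∙ b ≤ℚ a ∙ c) →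
                ∀ {e e′} → e ≤ℚ e′ → ∀ xs → foldr _∙_ e xs ≤ℚ foldr _∙_ e′ xs
foldr-monoʳ-≤ _∙_ mono e≤e′ []       = e≤e′
foldr-monoʳ-≤ _∙_ mono e≤e′ (x ∷ xs) = mono x (foldr-monoʳ-≤ _∙_ mono e≤e′ xs)

foldr-inflationary : ∀ (_∙_ : ℚ → ℚ → ℚ) {e xs} →
                     All (λ a → ∀ b → b ≤ℚ a ∙ b) xs → e ≤ℚ foldr _∙_ e xs
foldr-inflationary _∙_ All.[]             = ℚ.≤-refl
foldr-inflationary _∙_ (inflate All.∷ as) = ℚ.≤-trans (foldr-inflationary _∙_ as) (inflate _)

range-empty : ∀ y → range (suc y) y ≡ []
range-empty y = cong (map (suc y +ℕ_) ∘ upTo) (ℕ.n∸n≡0 y)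

range-singleton : ∀ x → range x x ≡ [ x ]
range-singleton x = trans (cong (map (x +ℕ_) ∘ upTo) (ℕ.m+n∸n≡m 1 x))
                          (cong [_] (ℕ.+-identityʳ x))

range-∷ʳ : ∀ {x y} → x ≤ suc y → range x y ∷ʳ suc y ≡ range x (suc y)
range-∷ʳ {x} {y} x≤1+y = begin
  map (x +ℕ_) (upTo (suc y ∸ x)) ∷ʳ suc y
    ≡⟨ cong (map (x +ℕ_) (upTo (suc y ∸ x)) ∷ʳ_) (sym (ℕ.m+[n∸m]≡n x≤1+y)) ⟩
  map (x +ℕ_) (upTo (suc y ∸ x)) ∷ʳ (x +ℕ (suc y ∸ x))
    ≡⟨ sym (map-++ (x +ℕ_) (upTo (suc y ∸ x)) [ suc y ∸ x ]) ⟩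
  map (x +ℕ_) (upTo (suc y ∸ x) ∷ʳ (suc y ∸ x))
    ≡⟨ cong (map (x +ℕ_)) (upTo-∷ʳ (suc y ∸ x)) ⟩
  map (x +ℕ_) (upTo (suc (suc y ∸ x)))
    ≡⟨ cong (map (x +ℕ_) ∘ upTo) (sym (ℕ.+-∸-assoc 1 x≤1+y)) ⟩
  range x (suc y) ∎
  where open ≡-Reasoning

range-++ : ∀ {x y z} → x ≤ suc y → y ≤ z → range x y ++ range (suc y) z ≡ range x z
range-++ {x} {y} x≤1+y y≤z = split (ℕ.≤⇒≤′ y≤z)
  where
  open ≡-Reasoning
  split : ∀ {z} → y ≤′ z → range x y ++ range (suc y) z ≡ range x z
  split ≤′-refl = trans (cong (range x y ++_) (range-empty y)) (++-identityʳ (range x y))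
  split (≤′-step {z} y≤′z) = begin
    range x y ++ range (suc y) (suc z)      ≡⟨ cong (range x y ++_) (sym (range-∷ʳ (s≤s y≤z′))) ⟩
    range x y ++ (range (suc y) z ∷ʳ suc z) ≡⟨ sym (++-assoc (range x y) (range (suc y) z) [ suc z ]) ⟩
    (range x y ++ range (suc y) z) ∷ʳ suc z ≡⟨ cong (_∷ʳ suc z) (split y≤′z) ⟩
    range x z ∷ʳ suc z                      ≡⟨ range-∷ʳ (ℕ.≤-trans x≤1+y (s≤s y≤z′)) ⟩
    range x (suc z)                         ∎
    where
    y≤z′ : y ≤ z
    y≤z′ = ℕ.≤′⇒≤ y≤′z

∈-range⁺ : ∀ {x y v} → x ≤ v → v ≤ y → v ∈ range x y
∈-range⁺ {x} {y} x≤v v≤y = subst (_∈ range x y) (ℕ.m+[n∸m]≡n x≤v)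
  (∈-map⁺ (x +ℕ_) (∈-upTo⁺ (ℕ.∸-monoˡ-< (s≤s v≤y) x≤v)))

∈-range⁻ : ∀ {x y v} → v ∈ range x y → x ≤ v × v ≤ y
∈-range⁻ {x} {y} v∈ with ∈-map⁻ (x +ℕ_) v∈
... | t , t∈ , refl =
  ℕ.m≤m+n x t , ℕ.≤-pred (subst (x +ℕ t <_) (ℕ.m+[n∸m]≡n x≤1+y) (ℕ.+-monoʳ-< x t<))
  where
  t< : t < suc y ∸ x
  t< = ∈-upTo⁻ t∈
  x≤1+y : x ≤ suc y
  x≤1+y = ℕ.<⇒≤ (ℕ.m∸n≢0⇒n<m (ℕ.m>n⇒m∸n≢0 (ℕ.≤-trans (s≤s z≤n) t<)))

foldr-range-++ : ∀ (_∙_ : ℚ → ℚ → ℚ) e (f : ℕ → ℚ) {x y z} → x ≤ suc y → y ≤ z →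
                 foldr _∙_ e (map f (range x z))
                   ≡ foldr _∙_ (foldr _∙_ e (map f (range (suc y) z))) (map f (range x y))
foldr-range-++ _∙_ e f {x} {y} {z} x≤1+y y≤z = begin
  foldr _∙_ e (map f (range x z))
    ≡⟨ cong (foldr _∙_ e ∘ map f) (sym (range-++ x≤1+y y≤z)) ⟩
  foldr _∙_ e (map f (range x y ++ range (suc y) z))
    ≡⟨ cong (foldr _∙_ e) (map-++ f (range x y) (range (suc y) z)) ⟩
  foldr _∙_ e (map f (range x y) ++ map f (range (suc y) z))
    ≡⟨ foldr-++ _∙_ e (map f (range x y)) (map f (range (suc y) z)) ⟩
  foldr _∙_ (foldr _∙_ e (map f (range (suc y) z))) (map f (range x y)) ∎
  where open ≡-Reasoning

module _ (w : ℕ → ℚ) (n : ℕ) (w-nonneg : ∀ v → 1 ≤ v → v ≤ n → 0ℚ ≤ℚ w v) where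

  private
    summands-inflationary : ∀ {x y} → 1 ≤ x → y ≤ n →
                            All (λ a → ∀ b → b ≤ℚ a + b) (map w (range x y))
    summands-inflationary 1≤x y≤n = All.map⁺ (All.tabulate λ v∈ b →
      let x≤v , v≤y = ∈-range⁻ v∈ in
      subst (_≤ℚ w _ + b) (ℚ.+-identityˡ b)
        (ℚ.+-monoˡ-≤ b (w-nonneg _ (ℕ.≤-trans 1≤x x≤v) (ℕ.≤-trans v≤y y≤n))))

  W-nonneg : ∀ {x y} → 1 ≤ x → y ≤ n → 0ℚ ≤ℚ W w x y
  W-nonneg 1≤x y≤n = foldr-inflationary _+_ (summands-inflationary 1≤x y≤n)

  W-extendʳ : ∀ {x y m} → x ≤ suc y → y ≤ m → m ≤ n → W w x y ≤ℚ W w x m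
  W-extendʳ {x} {y} x≤1+y y≤m m≤n =
    subst (W w x y ≤ℚ_) (sym (foldr-range-++ _+_ 0ℚ w x≤1+y y≤m))
      (foldr-monoʳ-≤ _+_ ℚ.+-monoʳ-≤ (W-nonneg {suc y} (s≤s z≤n) m≤n) (map w (range x y)))

  W-shrinkˡ : ∀ {x y m} → 1 ≤ x → x ≤ suc y → y ≤ m → m ≤ n → W w (suc y) m ≤ℚ W w x m
  W-shrinkˡ 1≤x x≤1+y y≤m m≤n =
    subst (_ ≤ℚ_) (sym (foldr-range-++ _+_ 0ℚ w x≤1+y y≤m))
      (foldr-inflationary _+_ (summands-inflationary 1≤x (ℕ.≤-trans y≤m m≤n)))

S-nonneg : ∀ s x y → 0ℚ ≤ℚ S s x y
S-nonneg s x y = foldr-inflationary _⊔_ (All.universal ℚ.p≤q⊔p (map s (range x y)))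

S-extendʳ : ∀ s {x y z} → x ≤ suc y → y ≤ z → S s x y ≤ℚ S s x z
S-extendʳ s {x} {y} {z} x≤1+y y≤z =
  subst (S s x y ≤ℚ_) (sym (foldr-range-++ _⊔_ 0ℚ s x≤1+y y≤z))
    (foldr-monoʳ-≤ _⊔_ (λ a → ℚ.⊔-monoʳ-≤ a) (S-nonneg s (suc y) z) (map s (range x y)))

S-head : ∀ s {x z} → x ≤ z → S s x z ≡ s x ⊔ S s (suc x) z
S-head s {x} {z} x≤z = trans (foldr-range-++ _⊔_ 0ℚ s (ℕ.n≤1+n x) x≤z)
  (cong (foldr _⊔_ (S s (suc x) z) ∘ map s) (range-singleton x))

1+n≰ᵇn : ∀ n → (suc n ≤ᵇℕ n) ≡ false
1+n≰ᵇn zero    = refl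
1+n≰ᵇn (suc n) = 1+n≰ᵇn n

FaWith-cong : ∀ (w0 c w s : ℕ → ℚ) {G G′ : ℕ → ℚ∞} a i → (∀ {j} → j < i → G j ≡ G′ j) →
              FaWith w0 c w s G a i ≡ FaWith w0 c w s G′ a i
FaWith-cong w0 c w s a i G≡G′ = cong minList (map-cong-local (All.tabulate λ {j} j∈ →
  cong (λ g → if W w (suc j) i ≤ᵇ w0 a then g +∞ fin (c a * S s (suc j) i) else ∞)
       (G≡G′ (∈-upTo⁻ j∈))))

IsReducedOption : (w0 w s : ℕ → ℚ) → ℕ → ℕ → ℕ → Set
IsReducedOption w0 w s a i j = IsBreakOption w0 w s a i j ⊎ IsMinOption w0 w a i j

reduced⇒option : ∀ {w0 w s a i j} → IsReducedOption w0 w s a i j → IsOption w0 w a i j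
reduced⇒option (inj₁ (option , _)) = option
reduced⇒option (inj₂ (option , _)) = option

module Instance (k n : ℕ) (w0 c w s : ℕ → ℚ) (1≤k : 1 ≤ k)
  (c-nonneg : ∀ a → 1 ≤ a → a ≤ k → 0ℚ ≤ℚ c a)
  (w-nonneg : ∀ v → 1 ≤ v → v ≤ n → 0ℚ ≤ℚ w v) where

  F′ : ℕ → ℚ∞
  F′ = F k w0 c w s

  Fa′ : ℕ → ℕ → ℚ∞
  Fa′ = Fa k w0 c w s

  cost : ℕ → ℕ → ℕ → ℚ∞
  cost = optCost k w0 c w s

  -- Fa′ a i is definitionally minList (map (candidate a i) (upTo i)).
  candidate : ℕ → ℕ → ℕ → ℚ∞
  candidate a i j = if W w (suc j) i ≤ᵇ w0 a then cost a i j else ∞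

  Ftab-stable : ∀ {m j} → j ≤ m → Ftab k w0 c w s m j ≡ F′ j
  Ftab-stable {zero} z≤n = refl
  Ftab-stable {suc m} j≤1+m with ℕ.m≤n⇒m<n∨m≡n j≤1+m
  ... | inj₂ refl      = refl
  ... | inj₁ (s≤s j≤m) =
    trans (if-cong (Equivalence.to T-≡ (ℕ.≤⇒≤ᵇ j≤m))) (Ftab-stable j≤m)

  F-suc : ∀ m → F′ (suc m) ≡ FWith k w0 c w s F′ (suc m)
  F-suc m = trans (if-cong (1+n≰ᵇn m))
    (cong minList (map-cong (λ a → FaWith-cong w0 c w s a (suc m) (Ftab-stable ∘′ ℕ.≤-pred)) (range 1 k)))

  F≤Fa : ∀ {a} m → 1 ≤ a → a ≤ k → F′ (suc m) ≤∞ Fa′ a (suc m)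
  F≤Fa {a} m 1≤a a≤k = subst (_≤∞ Fa′ a (suc m)) (sym (F-suc m))
    (minList-≤ (∈-map⁺ (λ a → Fa′ a (suc m)) (∈-range⁺ 1≤a a≤k)))

  F-attained : ∀ m → ∃ λ a → 1 ≤ a × a ≤ k × F′ (suc m) ≡ Fa′ a (suc m)
  F-attained m
    with ∈-map⁻ (λ a → Fa′ a (suc m))
                (minList-∈ (∈-map⁺ (λ a → Fa′ a (suc m)) (∈-range⁺ ℕ.≤-refl 1≤k)))
  ... | a , a∈ , eq = let 1≤a , a≤k = ∈-range⁻ a∈ in a , 1≤a , a≤k , trans (F-suc m) eq

  candidate-cases : ∀ a i j →
                    candidate a i j ≡ ∞ ⊎ (W w (suc j) i ≤ℚ w0 a × candidate a i j ≡ cost a i j)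
  candidate-cases a i j with W w (suc j) i ≤ᵇ w0 a | ℚ.≤ᵇ⇒≤ {W w (suc j) i} {w0 a}
  ... | true  | to-≤ = inj₂ (to-≤ _ , refl)
  ... | false | _     = inj₁ refl

  Fa-cases : ∀ a i → 1 ≤ i → Fa′ a i ≡ ∞ ⊎ ∃ λ j → IsOption w0 w a i j × Fa′ a i ≡ cost a i j
  Fa-cases a i 1≤i
    with ∈-map⁻ (candidate a i) (minList-∈ (∈-map⁺ (candidate a i) (∈-upTo⁺ 1≤i)))
  ... | j , j∈ , eq with candidate-cases a i j
  ...   | inj₁ ≡∞           = inj₁ (trans eq ≡∞)
  ...   | inj₂ (W≤ , ≡cost) = inj₂ (j , (∈-upTo⁻ j∈ , W≤) , trans eq ≡cost)

  Fa-≤-cost : ∀ {a i j} → IsOption w0 w a i j → Fa′ a i ≤∞ cost a i j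
  Fa-≤-cost {a} {i} (j<i , W≤) = subst (_ ≤∞_)
    (if-cong (Equivalence.to T-≡ (ℚ.≤⇒≤ᵇ W≤)))
    (minList-≤ (∈-map⁺ (candidate a i) (∈-upTo⁺ j<i)))

  c*-mono-≤ : ∀ {a p q} → 1 ≤ a → a ≤ k → p ≤ℚ q → c a * p ≤ℚ c a * q
  c*-mono-≤ {a} 1≤a a≤k = ℚ.*-monoˡ-≤-nonNeg (c a) {{nonNegative (c-nonneg a 1≤a a≤k)}}

  F≤cost : ∀ {a} i j → 1 ≤ a → a ≤ k → F′ j ≤∞ cost a i j
  F≤cost {a} i j 1≤a a≤k = x≤∞x+∞q (F′ j)
    (subst (_≤ℚ c a * S s (suc j) i) (ℚ.*-zeroʳ (c a)) (c*-mono-≤ 1≤a a≤k (S-nonneg s (suc j) i)))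

  cost-mono-S : ∀ {a} i i′ j → 1 ≤ a → a ≤ k →
                S s (suc j) i ≤ℚ S s (suc j) i′ → cost a i j ≤∞ cost a i′ j
  cost-mono-S i i′ j 1≤a a≤k S≤S′ = +∞-monoʳ-≤ (F′ j) (c*-mono-≤ 1≤a a≤k S≤S′)

  F≤cost-of-extension : ∀ {a m j} → 1 ≤ a → a ≤ k → suc m ≤ n →
                        IsOption w0 w a (suc m) j → F′ m ≤∞ cost a (suc m) j
  F≤cost-of-extension {m = m} 1≤a a≤k _ (s≤s j≤m , _) with ℕ.m≤n⇒m<n∨m≡n j≤m
  ... | inj₂ refl = F≤cost (suc m) m 1≤a a≤k
  F≤cost-of-extension {a} {suc m} {j} 1≤a a≤k 1+m≤n (_ , W≤) | inj₁ j<1+m = begin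
    F′ (suc m)         ≲⟨ F≤Fa m 1≤a a≤k ⟩
    Fa′ a (suc m)      ≲⟨ Fa-≤-cost (j<1+m , ℚ.≤-trans W-shorter W≤) ⟩
    cost a (suc m) j   ≲⟨ cost-mono-S (suc m) (suc (suc m)) j 1≤a a≤k
                             (S-extendʳ s (s≤s j≤1+m) (ℕ.n≤1+n (suc m))) ⟩
    cost a (suc (suc m)) j ∎
    where
    j≤1+m : j ≤ suc m
    j≤1+m = ℕ.<⇒≤ j<1+m
    W-shorter : W w (suc j) (suc m) ≤ℚ W w (suc j) (suc (suc m))
    W-shorter = W-extendʳ w n w-nonneg (s≤s j≤1+m) (ℕ.n≤1+n (suc m)) 1+m≤n
    open ≤∞-Reasoning

  F-mono-suc : ∀ {m} → suc m ≤ n → F′ m ≤∞ F′ (suc m)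
  F-mono-suc {m} 1+m≤n with F-attained m
  ... | a , 1≤a , a≤k , F≡Fa with Fa-cases a (suc m) (s≤s z≤n)
  ...   | inj₁ ≡∞ = subst (F′ m ≤∞_) (sym (trans F≡Fa ≡∞)) (_ ≤∞∞)
  ...   | inj₂ (j , option , ≡cost) =
    subst (F′ m ≤∞_) (sym (trans F≡Fa ≡cost)) (F≤cost-of-extension 1≤a a≤k 1+m≤n option)

  Fa-attained-by-option : ∀ {a i} → ∃ (IsOption w0 w a i) →
                          ∃ λ j → IsOption w0 w a i j × cost a i j ≤∞ Fa′ a i
  Fa-attained-by-option {a} {i} (j₀ , option₀@(j₀<i , _)) with Fa-cases a i (ℕ.≤-trans (s≤s z≤n) j₀<i)
  ... | inj₁ ≡∞                   = j₀ , option₀ , subst (cost a i j₀ ≤∞_) (sym ≡∞) (_ ≤∞∞)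
  ... | inj₂ (j , option , ≡cost) = j , option , subst (cost a i j ≤∞_) (sym ≡cost) ≤∞-refl

  module _ {a i} (1≤a : 1 ≤ a) (a≤k : a ≤ k) (i≤n : i ≤ n) where

    option-upward : ∀ {j′ j} → IsOption w0 w a i j′ → j′ ≤ j → j < i → IsOption w0 w a i j
    option-upward (_ , W≤) j′≤j j<i =
      j<i , ℚ.≤-trans (W-shrinkˡ w n w-nonneg (s≤s z≤n) (s≤s j′≤j) (ℕ.<⇒≤ j<i) i≤n) W≤

    cost-≤-of-non-break : ∀ {j} → suc j < i → ¬ (S s (suc (suc j)) i <ℚ s (suc j)) →
                          cost a i j ≤∞ cost a i (suc j)
    cost-≤-of-non-break {j} 1+j<i ¬break = begin
      F′ j +∞ fin (c a * S s (suc j) i)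
        ≡⟨ cong (λ x → F′ j +∞ fin (c a * x)) S-unchanged ⟩
      F′ j +∞ fin (c a * S s (suc (suc j)) i)
        ≲⟨ +∞-monoˡ-≤ _ (F-mono-suc (ℕ.≤-trans (ℕ.<⇒≤ 1+j<i) i≤n)) ⟩
      cost a i (suc j) ∎
      where
      open ≤∞-Reasoning
      S-unchanged : S s (suc j) i ≡ S s (suc (suc j)) i
      S-unchanged = trans (S-head s (ℕ.<⇒≤ 1+j<i)) (ℚ.p≤q⇒p⊔q≡q (ℚ.≮⇒≥ ¬break))

    reduced-option-below : ∀ {j} → IsOption w0 w a i j →
                           ∃ λ j′ → IsReducedOption w0 w s a i j′ × cost a i j′ ≤∞ cost a i j
    reduced-option-below {zero} option = zero , inj₂ (option , λ _ _ → z≤n) , ≤∞-refl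
    reduced-option-below {suc j} option@(1+j<i , _) with S s (suc (suc j)) i ℚ.<? s (suc j)
    ... | yes break = suc j , inj₁ (option , s≤s z≤n , break) , ≤∞-refl
    ... | no ¬break with W w (suc j) i ℚ.≤? w0 a
    ...   | yes W≤ =
      let j′ , reduced , cost≤ = reduced-option-below (ℕ.<⇒≤ 1+j<i , W≤)
      in j′ , reduced , ≤∞-trans cost≤ (cost-≤-of-non-break 1+j<i ¬break)
    ...   | no W≰ = suc j , inj₂ (option , minimal) , ≤∞-refl
      where
      minimal : ∀ j′ → IsOption w0 w a i j′ → suc j ≤ j′
      minimal j′ option′ = ℕ.≮⇒≥ λ j′<1+j →
        W≰ (proj₂ (option-upward option′ (ℕ.≤-pred j′<1+j) (ℕ.<⇒≤ 1+j<i)))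

    reduced-options-suffice : ∃ (IsOption w0 w a i) →
      (∃ λ j → IsReducedOption w0 w s a i j × cost a i j ≡ Fa′ a i) ×
      (∀ j → IsReducedOption w0 w s a i j → Fa′ a i ≤∞ cost a i j)
    reduced-options-suffice options with Fa-attained-by-option options
    ... | _ , option₀ , cost₀≤Fa with reduced-option-below option₀
    ...   | j , reduced , cost≤cost₀ =
      (j , reduced , ≤∞-antisym (≤∞-trans cost≤cost₀ cost₀≤Fa) (Fa-≤-reduced j reduced)) ,
      Fa-≤-reduced
      where
      Fa-≤-reduced : ∀ j → IsReducedOption w0 w s a i j → Fa′ a i ≤∞ cost a i j
      Fa-≤-reduced _ = Fa-≤-cost ∘ reduced⇒option {w0} {w} {s}

lemma4 : (k n : ℕ) (w0 c w s : ℕ → ℚ)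
    → (∀ a → 1 ≤ a → a ≤ k → 0ℚ ≤ℚ w0 a)
    → (∀ a → 1 ≤ a → a ≤ k → 0ℚ ≤ℚ c a)
    → (∀ v → 1 ≤ v → v ≤ n → 0ℚ ≤ℚ w v)
    → (∀ v → 1 ≤ v → v ≤ n → 0ℚ ≤ℚ s v)
    → (a i : ℕ) → 1 ≤ a → a ≤ k → 1 ≤ i → i ≤ n
    → ∃ (λ j → IsOption w0 w a i j)
    → (Σ ℕ (λ j → (IsBreakOption w0 w s a i j ⊎ IsMinOption w0 w a i j)
                 × optCost k w0 c w s a i j ≡ Fa k w0 c w s a i))
      × (∀ j → (IsBreakOption w0 w s a i j ⊎ IsMinOption w0 w a i j)
             → Fa k w0 c w s a i ≤∞ optCost k w0 c w s a i j)
lemma4 k n w0 c w s _ c-nonneg w-nonneg _ a i 1≤a a≤k _ i≤n =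
  reduced-options-suffice 1≤a a≤k i≤n
  where open Instance k n w0 c w s (ℕ.≤-trans 1≤a a≤k) c-nonneg w-nonneg
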